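{- In LP$^{\mathrm{MLN}}$ (i.e. with respect to semi-strong equivalence $\equiv_{s,s}$), the S-RP transformation is both SE-preserving and NSE-preserving.
   Context: Atoms are propositional. A rule $r$ is an expression $h_1\vee\cdots\vee h_k\leftarrow b_1,\dots,b_m,\mathit{not}\,c_1,\dots,\mathit{not}\,c_n$ ($k,m,n\ge 0$) with atoms $h_i,b_i,c_i$; write $H(r)=\{h_1,\dots,h_k\}$, $B^+(r)=\{b_1,\dots,b_m\}$, $B^-(r)=\{c_1,\dots,c_n\}$. A program is a finite set of rules. An interpretation is a set $X$ of atoms; $X\models r$ iff $X\cap H(r)\neq\emptyset$ or $B^+(r)\not\subseteq X$ or $B^-(r)\cap X\neq\emptyset$; $X\models P$ iff $X$ satisfies every rule of $P$. The GL-reduct is $P^X=\{H(r)\leftarrow B^+(r) : r\in P,\ B^-(r)\cap X=\emptyset\}$; $X$ is an ASP stable model of $P$ iff $X\models P^X$ and no proper subset of $X$ satisfies $P^X$. LP$^{\mathrm{MLN}}$ rules carry weights, but weights are irrelevant here and omitted, so an LP$^{\mathrm{MLN}}$ program is just a program; $X$ is an LP$^{\mathrm{MLN}}$ stable model of $P$ iff $X$ is an ASP stable model of $P_X=\{r\in P: X\models r\}$. Programs $P,Q$ are semi-strongly equivalent, $P\equiv_{s,s}Q$, iff for every program $R$, $P\cup R$ and $Q\cup R$ have the same LP$^{\mathrm{MLN}}$ stable models. Tuples and independent sets: programs are regarded as tuples of rules (repetitions allowed); for $P=\langle r_1,\dots,r_p\rangle$, $Q=\langle t_1,\dots,t_q\rangle$,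 $\langle P,Q\rangle=\langle r_1,\dots,r_p,t_1,\dots,t_q\rangle$. For a tuple $T=\langle r_1,\dots,r_n\rangle$ let $at(T)$ be its set of atoms and $\langle S_1,\dots,S_{3n}\rangle=\langle H(r_1),B^+(r_1),B^-(r_1),\dots,H(r_n),B^+(r_n),B^-(r_n)\rangle$. For each nonempty $N'\subseteq\{1,\dots,3n\}$ the independent set is $I_{N'}=\bigcap_{i\in N'}S_i\setminus\bigcup_{j\in\{1,\dots,3n\}\setminus N'}S_j$; it is named $I_k$ with $k=\sum_{i\in N'}2^{3n-i}$, $1\le k<2^{3n}$. Independent sets are pairwise disjoint and cover $at(T)$. S-* transformations: let $I_k=I_{N'}$ be an independent set of $T$ and $a'\notin at(T)$ a fresh atom. Replacing $a\in I_k$ by $a'$ means renaming every occurrence of $a$ in $T$ to $a'$; deleting $a\in I_k$ means removing $a$ from every rule of $T$; adding $a'$ to $I_k$ means adding $a'$ to each $S_i$ with $i\in N'$. S-RP: replace some $a\in I_k$ by $a'$ (requires $|I_k|>0$); S-DL: delete some $a\in I_k$, requires $|I_k|>2$; S-RD-$i$ ($i\in\{1,2\}$): delete some $a\in I_k$, requires $|I_k|=i$; S-AD: add $a'$ to $I_k$, requires $|I_k|\ge 2$; S-EX-$i$ ($i\in\{0,1\}$): add $a'$ to $I_k$, requires $|I_k|=i$. For a pair $T=\langle P,Q\rangle$ the result is $T^\circ=\langle P^\circ,Q^\circ\rangle$ where $P^\circ$ consists of the first $|P|$ rules. For a given equivalence $\equiv$, a transformation type is SE-preserving if for every pair $\langle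 P,Q\rangle$ and every admissible application, $P\equiv Q$ implies $P^\circ\equiv Q^\circ$; it is NSE-preserving if $P\not\equiv Q$ implies $P^\circ\not\equiv Q^\circ$. -}

module Defs where

open import Data.Nat using (ℕ; _≡ᵇ_)
open import Data.Bool using (Bool; true; false; not; _∨_; if_then_else_)
open import Data.Bool.ListAction using (any; all)
open import Data.List using (List; []; _∷_; _++_; map; concat; concatMap; filterᵇ; take; drop; length)
open import Data.List.Membership.Propositional using (_∈_; _∉_)
open import Data.List.Relation.Unary.Any using (Any)
open import Data.List.Relation.Binary.Pointwise using (Pointwise)
open import Data.Product using (_×_; ∃)
open import Relation.Binary.PropositionalEquality using (_≡_)
open import Relation.Nullary using (¬_)
open import Function.Bundles using (_⇔_)

-- Atoms are natural numbers (an infinite supply, so fresh atoms exist).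
Atom : Set
Atom = ℕ

-- A rule  H ← B⁺, not B⁻  (finite sets of atoms given as lists).
record Rule : Set where
  constructor rule
  field
    H  : List Atom
    Bp : List Atom
    Bn : List Atom
open Rule public

-- Programs are tuples (lists) of rules; repetitions allowed.
Program : Set
Program = List Rule

Interp : Set
Interp = Atom → Bool

satᵇ : Interp → Rule → Bool
satᵇ X r = any X (H r) ∨ (not (all X (Bp r)) ∨ any X (Bn r))

Sat : Interp → Rule → Set
Sat X r = satᵇ X r ≡ true

SatP : Interp → Program → Set
SatP X P = ∀ r → r ∈ P → Sat X r

reduct : Program → Interp → Program
reduct P X = map (λ r → rule (H r) (Bp r) []) (filterᵇ (λ r → not (any X (Bn r))) P)

_⊂_ : Interp → Interp → Set
Y ⊂ X = (∀ a → Y a ≡ true → X a ≡ true) × ∃ (λ a → X a ≡ true × Y a ≡ false)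

ASPStable : Program → Interp → Set
ASPStable P X = SatP X (reduct P X) × (∀ Y → Y ⊂ X → ¬ SatP Y (reduct P X))

satPart : Program → Interp → Program
satPart P X = filterᵇ (satᵇ X) P

LPMLNStable : Program → Interp → Set
LPMLNStable P X = ASPStable (satPart P X) X

-- Semi-strong equivalence  P ≡_{s,s} Q   (P ∪ R rendered as P ++ R)
_≡ss_ : Program → Program → Set
P ≡ss Q = ∀ (R : Program) (X : Interp) → LPMLNStable (P ++ R) X ⇔ LPMLNStable (Q ++ R) X

Ss : Program → List (List Atom)
Ss T = concatMap (λ r → H r ∷ Bp r ∷ Bn r ∷ []) T

at : Program → List Atom
at T = concat (Ss T)

-- N' ⊆ {1,…,3n} given by its characteristic vector (length 3n, enforced by Pointwise).
-- a ∈ I_{N'}  iff  N' nonempty and for every i: a ∈ Sᵢ ⇔ i ∈ N'.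
InIndep : Program → List Bool → Atom → Set
InIndep T N' a = Any (_≡ true) N' × Pointwise (λ b S → (b ≡ true) ⇔ (a ∈ S)) N' (Ss T)

renAtom : Atom → Atom → Atom → Atom
renAtom a a' x = if x ≡ᵇ a then a' else x

renRule : Atom → Atom → Rule → Rule
renRule a a' r = rule (map (renAtom a a') (H r)) (map (renAtom a a') (Bp r)) (map (renAtom a a') (Bn r))

-- S-RP applied to the tuple T = ⟨P,Q⟩, then split: P° = first |P| rules, Q° = the rest.
SRP : Atom → Atom → Program → Program → Program × Program
SRP a a' P Q = take (length P) T° Data.Product., drop (length P) T°
  where T° = map (renRule a a') (P ++ Q)

{-# OPTIONS --safe #-}
-- Since a′ does not occur in ⟨P,Q⟩, renaming a to a′ acts on ⟨P,Q⟩ exactly as the transposition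
-- τ = (a a′) of atoms, and τ is an involution. Renaming by an involution f is a symmetry of the
-- semantics: satisfaction, the part P_X satisfied by X, the GL-reduct and proper inclusion all
-- commute with it, so X is an LP^MLN stable model of f(P) iff X ∘ f is one of P. Adding f(R) to
-- both sides then shows that f preserves ≡ss, and as f undoes itself it also reflects ≡ss.
module Submission where

open import Defs
open import Data.Bool using (Bool; true; false; not; _∨_; if_then_else_)
open import Data.Bool.ListAction using (any; all; and; or)
open import Data.Nat using (ℕ; _≟_; _≡ᵇ_)
open import Data.List using (List; []; _∷_; _++_; map; filterᵇ; take; drop; length)
open import Data.List.Properties using (map-++; map-∘; map-cong; map-cong-local; map-id; take-map; drop-map)
open import Data.List.Membership.Propositional using (_∉_)
open import Data.List.Membership.Propositional.Properties using (∈-map⁺; ∈-map⁻; ∈-++⁺ˡ; ∈-++⁺ʳ)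
import Data.List.Relation.Unary.All as All
open import Data.List.Relation.Unary.All.Properties using (¬Any⇒All¬)
open import Data.Product using (_×_; _,_; proj₁; proj₂)
open import Data.Product.Function.NonDependent.Propositional using (_×-⇔_)
open import Function using (id; _∘_; _⇔_; mk⇔; Equivalence)
open import Function.Construct.Symmetry using (⇔-sym)
open import Function.Related.Propositional using (module EquationalReasoning)
open import Relation.Binary.PropositionalEquality
  using (_≡_; _≢_; _≗_; refl; sym; trans; cong; cong₂; subst; subst₂; module ≡-Reasoning)
open import Relation.Nullary using (¬_; yes; no)
open import Relation.Nullary.Decidable using (dec-true; dec-false)
open import Algebra.Definitions (_≡_ {A = Atom}) using (Involutive)

cong-rule : ∀ {h h′ b b′ n n′} → h ≡ h′ → b ≡ b′ → n ≡ n′ → rule h b n ≡ rule h′ b′ n′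
cong-rule refl refl refl = refl

renameRule : (Atom → Atom) → Rule → Rule
renameRule f r = rule (map f (H r)) (map f (Bp r)) (map f (Bn r))

renameProgram : (Atom → Atom) → Program → Program
renameProgram f = map (renameRule f)

any-map : ∀ (X : Interp) (f : Atom → Atom) xs → any X (map f xs) ≡ any (X ∘ f) xs
any-map X f xs = cong or (sym (map-∘ xs))

all-map : ∀ (X : Interp) (f : Atom → Atom) xs → all X (map f xs) ≡ all (X ∘ f) xs
all-map X f xs = cong and (sym (map-∘ xs))

any-cong : ∀ {X Y : Interp} → X ≗ Y → ∀ xs → any X xs ≡ any Y xs
any-cong X≗Y xs = cong or (map-cong X≗Y xs)

all-cong : ∀ {X Y : Interp} → X ≗ Y → ∀ xs → all X xs ≡ all Y xs
all-cong X≗Y xs = cong and (map-cong X≗Y xs)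

satᵇ-rename : ∀ X f r → satᵇ X (renameRule f r) ≡ satᵇ (X ∘ f) r
satᵇ-rename X f r =
  cong₂ _∨_ (any-map X f (H r)) (cong₂ _∨_ (cong not (all-map X f (Bp r))) (any-map X f (Bn r)))

satᵇ-cong : ∀ {X Y : Interp} → X ≗ Y → ∀ r → satᵇ X r ≡ satᵇ Y r
satᵇ-cong X≗Y r =
  cong₂ _∨_ (any-cong X≗Y (H r)) (cong₂ _∨_ (cong not (all-cong X≗Y (Bp r))) (any-cong X≗Y (Bn r)))

SatP-cong : ∀ {X Y : Interp} → X ≗ Y → ∀ P → SatP X P → SatP Y P
SatP-cong X≗Y P sat r r∈P = trans (sym (satᵇ-cong X≗Y r)) (sat r r∈P)

SatP-rename : ∀ f P X → SatP X (renameProgram f P) ⇔ SatP (X ∘ f) P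
SatP-rename f P X = mk⇔ to from
  where
  to : SatP X (renameProgram f P) → SatP (X ∘ f) P
  to sat r r∈P = trans (sym (satᵇ-rename X f r)) (sat _ (∈-map⁺ _ r∈P))
  from : SatP (X ∘ f) P → SatP X (renameProgram f P)
  from sat r r∈ with ∈-map⁻ _ r∈
  ... | r′ , r′∈P , refl = trans (satᵇ-rename X f r′) (sat r′ r′∈P)

filterᵇ-map : ∀ {A B : Set} (p : B → Bool) (q : A → Bool) (g : A → B) →
              p ∘ g ≗ q → filterᵇ p ∘ map g ≗ map g ∘ filterᵇ q
filterᵇ-map p q g pg≗q [] = refl
filterᵇ-map p q g pg≗q (x ∷ xs) rewrite pg≗q x with q x
... | true  = cong (g x ∷_) (filterᵇ-map p q g pg≗q xs)
... | false = filterᵇ-map p q g pg≗q xs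

satPart-rename : ∀ f P X → satPart (renameProgram f P) X ≡ renameProgram f (satPart P (X ∘ f))
satPart-rename f P X = filterᵇ-map (satᵇ X) (satᵇ (X ∘ f)) (renameRule f) (satᵇ-rename X f) P

reduct-rename : ∀ f P X → reduct (renameProgram f P) X ≡ renameProgram f (reduct P (X ∘ f))
reduct-rename f P X =
  trans (cong (map positivePart) (filterᵇ-map _ _ (renameRule f) (λ r → cong not (any-map X f (Bn r))) P))
        (trans (sym (map-∘ _)) (map-∘ _))
  where
  positivePart : Rule → Rule
  positivePart r = rule (H r) (Bp r) []

Minimal : Interp → Program → Set
Minimal X P = ∀ Y → Y ⊂ X → ¬ SatP Y P

module _ (f : Atom → Atom) (f-inv : Involutive f) where

  ⊂-rename : ∀ {X Y} → Y ⊂ X → (Y ∘ f) ⊂ (X ∘ f)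
  ⊂-rename {X} {Y} (Y⊆X , a , Xa , ¬Ya) =
    (λ b → Y⊆X (f b)) , f a ,
    subst (λ z → X z ≡ true) (sym (f-inv a)) Xa , subst (λ z → Y z ≡ false) (sym (f-inv a)) ¬Ya

  ⊂-rename⁻ : ∀ {X Y} → Y ⊂ (X ∘ f) → (Y ∘ f) ⊂ X
  ⊂-rename⁻ {X} {Y} (Y⊆Xf , a , Xfa , ¬Ya) =
    (λ b Yfb → subst (λ z → X z ≡ true) (f-inv b) (Y⊆Xf (f b) Yfb)) , f a ,
    Xfa , subst (λ z → Y z ≡ false) (sym (f-inv a)) ¬Ya

  Minimal-rename : ∀ P X → Minimal X (renameProgram f P) ⇔ Minimal (X ∘ f) P
  Minimal-rename P X = mk⇔ to from
    where
    to : Minimal X (renameProgram f P) → Minimal (X ∘ f) P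
    to min Y Y⊂Xf satY = min (Y ∘ f) (⊂-rename⁻ Y⊂Xf)
      (Equivalence.from (SatP-rename f P (Y ∘ f)) (SatP-cong (λ b → cong Y (sym (f-inv b))) P satY))
    from : Minimal (X ∘ f) P → Minimal X (renameProgram f P)
    from min Y Y⊂X satY = min (Y ∘ f) (⊂-rename Y⊂X) (Equivalence.to (SatP-rename f P Y) satY)

  ASPStable-rename : ∀ P X → ASPStable (renameProgram f P) X ⇔ ASPStable P (X ∘ f)
  ASPStable-rename P X = begin
    ASPStable (renameProgram f P) X
      ≡⟨ cong (λ R → SatP X R × Minimal X R) (reduct-rename f P X) ⟩
    (SatP X (renameProgram f R) × Minimal X (renameProgram f R))
      ∼⟨ SatP-rename f R X ×-⇔ Minimal-rename R X ⟩
    ASPStable P (X ∘ f) ∎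
    where
    open EquationalReasoning
    R : Program
    R = reduct P (X ∘ f)

  LPMLNStable-rename : ∀ P X → LPMLNStable (renameProgram f P) X ⇔ LPMLNStable P (X ∘ f)
  LPMLNStable-rename P X = begin
    LPMLNStable (renameProgram f P) X
      ≡⟨ cong (λ R → ASPStable R X) (satPart-rename f P X) ⟩
    ASPStable (renameProgram f (satPart P (X ∘ f))) X
      ∼⟨ ASPStable-rename (satPart P (X ∘ f)) X ⟩
    LPMLNStable P (X ∘ f) ∎
    where open EquationalReasoning

  renameProgram-involutive : ∀ P → renameProgram f (renameProgram f P) ≡ P
  renameProgram-involutive P = begin
    renameProgram f (renameProgram f P) ≡⟨ map-∘ P ⟨
    map (renameRule f ∘ renameRule f) P ≡⟨ map-cong renameRule-involutive P ⟩
    map id P                             ≡⟨ map-id P ⟩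
    P                                    ∎
    where
    open ≡-Reasoning
    map-involutive : ∀ xs → map f (map f xs) ≡ xs
    map-involutive xs = trans (sym (map-∘ xs)) (trans (map-cong f-inv xs) (map-id xs))
    renameRule-involutive : ∀ r → renameRule f (renameRule f r) ≡ r
    renameRule-involutive r = cong-rule (map-involutive (H r)) (map-involutive (Bp r)) (map-involutive (Bn r))

  ≡ss-rename : ∀ P Q → P ≡ss Q → renameProgram f P ≡ss renameProgram f Q
  ≡ss-rename P Q P≡Q R X = begin
    LPMLNStable (renameProgram f P ++ R) X
      ≡⟨ cong (λ T → LPMLNStable T X) (rename-++-rename P) ⟨
    LPMLNStable (renameProgram f (P ++ renameProgram f R)) X
      ∼⟨ LPMLNStable-rename (P ++ renameProgram f R) X ⟩
    LPMLNStable (P ++ renameProgram f R) (X ∘ f)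
      ∼⟨ P≡Q (renameProgram f R) (X ∘ f) ⟩
    LPMLNStable (Q ++ renameProgram f R) (X ∘ f)
      ∼⟨ ⇔-sym (LPMLNStable-rename (Q ++ renameProgram f R) X) ⟩
    LPMLNStable (renameProgram f (Q ++ renameProgram f R)) X
      ≡⟨ cong (λ T → LPMLNStable T X) (rename-++-rename Q) ⟩
    LPMLNStable (renameProgram f Q ++ R) X ∎
    where
    open EquationalReasoning
    rename-++-rename : ∀ S → renameProgram f (S ++ renameProgram f R) ≡ renameProgram f S ++ R
    rename-++-rename S =
      trans (map-++ _ S (renameProgram f R)) (cong (renameProgram f S ++_) (renameProgram-involutive R))

  ≡ss-rename⁻ : ∀ P Q → renameProgram f P ≡ss renameProgram f Q → P ≡ss Q
  ≡ss-rename⁻ P Q fP≡fQ =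
    subst₂ _≡ss_ (renameProgram-involutive P) (renameProgram-involutive Q)
      (≡ss-rename (renameProgram f P) (renameProgram f Q) fP≡fQ)

transpose : Atom → Atom → Atom → Atom
transpose a b x = if x ≡ᵇ a then b else (if x ≡ᵇ b then a else x)

module _ (a b : Atom) where

  transpose-left : transpose a b a ≡ b
  transpose-left rewrite dec-true (a ≟ a) refl = refl

  transpose-right : transpose a b b ≡ a
  transpose-right with b ≟ a
  ... | yes refl rewrite dec-true (b ≟ b) refl = refl
  ... | no b≢a rewrite dec-false (b ≟ a) b≢a | dec-true (b ≟ b) refl = refl

  transpose-other : ∀ {x} → x ≢ a → x ≢ b → transpose a b x ≡ x
  transpose-other {x} x≢a x≢b rewrite dec-false (x ≟ a) x≢a | dec-false (x ≟ b) x≢b = refl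

  transpose-involutive : Involutive (transpose a b)
  transpose-involutive x with x ≟ a | x ≟ b
  ... | yes refl | _        = trans (cong (transpose a b) transpose-left) transpose-right
  ... | no _     | yes refl = trans (cong (transpose a b) transpose-right) transpose-left
  ... | no x≢a   | no x≢b   =
    trans (cong (transpose a b) (transpose-other x≢a x≢b)) (transpose-other x≢a x≢b)

∉-++⁻ : ∀ {A : Set} {x : A} xs {ys} → x ∉ xs ++ ys → x ∉ xs × x ∉ ys
∉-++⁻ xs x∉xs++ys = x∉xs++ys ∘ ∈-++⁺ˡ , x∉xs++ys ∘ ∈-++⁺ʳ xs

module _ {a a′ : Atom} where

  renAtom-fresh : ∀ {x} → a′ ≢ x → renAtom a a′ x ≡ transpose a a′ x
  renAtom-fresh {x} a′≢x with x ≡ᵇ a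
  ... | true  = refl
  ... | false rewrite dec-false (x ≟ a′) (a′≢x ∘ sym) = refl

  map-renAtom-fresh : ∀ {xs} → a′ ∉ xs → map (renAtom a a′) xs ≡ map (transpose a a′) xs
  map-renAtom-fresh {xs} a′∉xs = map-cong-local (All.map renAtom-fresh (¬Any⇒All¬ xs a′∉xs))

  map-renRule-fresh : ∀ T → a′ ∉ at T → map (renRule a a′) T ≡ renameProgram (transpose a a′) T
  map-renRule-fresh []      _     = refl
  map-renRule-fresh (r ∷ T) a′∉rT =
    let a′∉H  , a′∉BpBnT = ∉-++⁻ (H r) a′∉rT
        a′∉Bp , a′∉BnT   = ∉-++⁻ (Bp r) a′∉BpBnT
        a′∉Bn , a′∉T     = ∉-++⁻ (Bn r) a′∉BnT
    in cong₂ _∷_ (cong-rule (map-renAtom-fresh a′∉H) (map-renAtom-fresh a′∉Bp) (map-renAtom-fresh a′∉Bn))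
                 (map-renRule-fresh T a′∉T)

take-length-++ : ∀ {A : Set} (xs ys : List A) → take (length xs) (xs ++ ys) ≡ xs
take-length-++ []       ys = refl
take-length-++ (x ∷ xs) ys = cong (x ∷_) (take-length-++ xs ys)

drop-length-++ : ∀ {A : Set} (xs ys : List A) → drop (length xs) (xs ++ ys) ≡ ys
drop-length-++ []       ys = refl
drop-length-++ (x ∷ xs) ys = drop-length-++ xs ys

SRP≡rename-transpose : ∀ {a a′} P Q → a′ ∉ at (P ++ Q) →
            SRP a a′ P Q ≡ (renameProgram (transpose a a′) P , renameProgram (transpose a a′) Q)
SRP≡rename-transpose {a} {a′} P Q a′∉PQ = begin
  SRP a a′ P Q
    ≡⟨ cong (λ T → take n T , drop n T) (map-renRule-fresh (P ++ Q) a′∉PQ) ⟩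
  take n (rename (P ++ Q)) , drop n (rename (P ++ Q))
    ≡⟨ cong₂ _,_ (take-map n (P ++ Q)) (drop-map n (P ++ Q)) ⟩
  rename (take n (P ++ Q)) , rename (drop n (P ++ Q))
    ≡⟨ cong₂ _,_ (cong rename (take-length-++ P Q)) (cong rename (drop-length-++ P Q)) ⟩
  rename P , rename Q ∎
  where
  open ≡-Reasoning
  n : ℕ
  n = length P
  rename : Program → Program
  rename = renameProgram (transpose a a′)

theorem2 : ∀ (P Q : Program) (N' : List Bool) (a a' : Atom)
           → InIndep (P ++ Q) N' a
           → a' ∉ at (P ++ Q)
           → ((P ≡ss Q → proj₁ (SRP a a' P Q) ≡ss proj₂ (SRP a a' P Q))
             × (¬ (P ≡ss Q) → ¬ (proj₁ (SRP a a' P Q) ≡ss proj₂ (SRP a a' P Q))))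
theorem2 P Q _ a a' _ a'∉PQ =
  subst Preserves (sym (SRP≡rename-transpose P Q a'∉PQ))
    (≡ss-rename τ τ-involutive P Q , λ P≢Q → P≢Q ∘ ≡ss-rename⁻ τ τ-involutive P Q)
  where
  τ : Atom → Atom
  τ = transpose a a'
  τ-involutive : Involutive τ
  τ-involutive = transpose-involutive a a'
  Preserves : Program × Program → Set
  Preserves T = (P ≡ss Q → proj₁ T ≡ss proj₂ T) × (¬ (P ≡ss Q) → ¬ (proj₁ T ≡ss proj₂ T))
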